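{- Let $p$ be a prime with $p\equiv 1\pmod 4$. Then $$\prod_{1\leq i<j\leq \frac{p-1}{2}}(j^2-i^2)\equiv -\Big(\frac{p-1}{2}\Big)!\pmod p.$$ -}

module Defs where

open import Data.Nat using (ℕ; zero; suc)
open import Data.Integer using (ℤ; +_; _-_; _*_)

prodFrom1 : ℕ → (ℕ → ℤ) → ℤ
prodFrom1 zero    f = + 1
prodFrom1 (suc k) f = prodFrom1 k f * f (suc k)

-- ∏_{1 ≤ i < j ≤ m} (j² - i²), computed in ℤ
--   = ∏_{j=1}^{m} ∏_{i=1}^{j-1} (j² - i²)
pairProd : ℕ → ℤ
pairProd m = prodFrom1 m (λ j → prodFrom1 (Data.Nat._∸_ j 1)
                 (λ i → (+ j * + j) - (+ i * + i)))

{-# OPTIONS --safe #-}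
-- Write m = (p-1)/2. Since j² - i² = (j - i)(j + i), the j-th row satisfies
-- j · ∏_{i<j} (j² - i²) = (2j-1)!, so the double product times m! is ∏_{j≤m} (2j-1)!.
-- If a + b = p - 1, then (p-1)! = a! · ∏_{i≤b} (a + i) with a + i ≡ -(b + 1 - i), so Wilson's
-- theorem gives (-1)^b · a! · b! ≡ -1 (mod p). As p ≡ 1 (mod 4), m is even: pairing j with
-- m + 1 - j makes the odd factorials multiply to 1, while m!² ≡ -1. Hence
-- (double product + m!) · m! ≡ 0, and m! is a unit. Wilson's theorem itself pairs every k in
-- 2..p-2 with its inverse; both pairings are instances of one lemma on products over an involution.
module Submission where

open import Defs
open import Data.Bool.Base using (if_then_else_)
open import Data.Integer.Base
  using (ℤ; +_; -_; _+_; _-_; _*_; _^_; 0ℤ; 1ℤ; -1ℤ; ∣_∣; _%ℕ_; _/ℕ_)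
open import Data.Integer.Divisibility using (_∣_)
import Data.Integer.Divisibility.Signed as Signed
open import Data.Integer.Divisibility.Signed
  using (divides; ∣m∣n⇒∣m+n; ∣m⇒∣-m; ∣m⇒∣m*n; ∣n⇒∣m*n; ∣⇒∣ᵤ; ∣ᵤ⇒∣)
open import Data.Integer.DivMod using (a≡a%ℕn+[a/ℕn]*n; n%ℕd<d)
import Data.Integer.Properties as ℤ
open import Algebra.Properties.CommutativeSemigroup ℤ.*-commutativeSemigroup
  using (interchange; x∙yz≈y∙xz; xy∙z≈y∙xz; xy∙z≈xz∙y; xy∙z≈x∙zy)
open import Data.Integer.Tactic.RingSolver using (solve-∀)
open import Data.Nat
  using (ℕ; zero; suc; _≤_; _<_; _!; _/_; _%_; _∸_; z≤n; s≤s; NonZero; _≤?_)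
import Data.Nat as ℕ
open import Data.Nat.Coprimality using (coprime⇒gcd≡1; prime⇒coprime)
  renaming (sym to coprime-sym)
import Data.Nat.Divisibility as ℕ
open import Data.Nat.DivMod using (m≡m%n+[m/n]*n; m*n/n≡m)
open import Data.Nat.GCD using (gcd; gcd-GCD; module Bézout)
open import Data.Nat.Primality using (Prime; euclidsLemma; prime⇒nonZero; prime⇒nonTrivial)
import Data.Nat.Properties as ℕ
import Data.Nat.Tactic.RingSolver as ℕ-Solver
open import Data.Product using (Σ-syntax; _×_; _,_; proj₁; proj₂)
import Data.Sum as Sum
open import Data.Sum using (_⊎_; inj₁; inj₂)
open import Function using (_∘_; id)
open import Level using (0ℓ)
open import Relation.Binary.Bundles using (Setoid)
import Relation.Binary.Reasoning.Setoid as SetoidReasoning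
open import Relation.Binary.PropositionalEquality
open import Relation.Nullary using (¬_; does; yes; no; contradiction)
open import Relation.Nullary.Decidable using (dec-true; dec-false)

∏ : ℕ → (ℕ → ℤ) → ℤ
∏ = prodFrom1

module _ where
  open ≡-Reasoning

  ∏-cong : ∀ n {f g : ℕ → ℤ} → (∀ {k} → 1 ≤ k → k ≤ n → f k ≡ g k) → ∏ n f ≡ ∏ n g
  ∏-cong zero    f≗g = refl
  ∏-cong (suc n) f≗g =
    cong₂ _*_ (∏-cong n λ 1≤k k≤n → f≗g 1≤k (ℕ.m≤n⇒m≤1+n k≤n)) (f≗g (s≤s z≤n) ℕ.≤-refl)

  ∏-distrib-* : ∀ n (f g : ℕ → ℤ) → ∏ n (λ k → f k * g k) ≡ ∏ n f * ∏ n g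
  ∏-distrib-* zero    f g = refl
  ∏-distrib-* (suc n) f g = begin
    ∏ n (λ k → f k * g k) * (f (suc n) * g (suc n))
      ≡⟨ cong (_* (f (suc n) * g (suc n))) (∏-distrib-* n f g) ⟩
    ∏ n f * ∏ n g * (f (suc n) * g (suc n))
      ≡⟨ interchange (∏ n f) (∏ n g) (f (suc n)) (g (suc n)) ⟩
    ∏ n f * f (suc n) * (∏ n g * g (suc n))
      ∎

  ∏-const : ∀ n c → ∏ n (λ _ → c) ≡ c ^ n
  ∏-const zero    c = refl
  ∏-const (suc n) c = trans (cong (_* c) (∏-const n c)) (ℤ.*-comm (c ^ n) c)

  ∏-neg : ∀ n (f : ℕ → ℤ) → ∏ n (λ k → - f k) ≡ -1ℤ ^ n * ∏ n f
  ∏-neg n f = begin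
    ∏ n (λ k → - f k)          ≡⟨ ∏-cong n (λ _ _ → sym (ℤ.-1*i≡-i _)) ⟩
    ∏ n (λ k → -1ℤ * f k)      ≡⟨ ∏-distrib-* n (λ _ → -1ℤ) f ⟩
    ∏ n (λ _ → -1ℤ) * ∏ n f    ≡⟨ cong (_* ∏ n f) (∏-const n -1ℤ) ⟩
    -1ℤ ^ n * ∏ n f            ∎

  ∏-shift : ∀ n (f : ℕ → ℤ) → ∏ (suc n) f ≡ f 1 * ∏ n (f ∘ suc)
  ∏-shift zero    f = ℤ.*-comm 1ℤ (f 1)
  ∏-shift (suc n) f = begin
    ∏ (suc n) f * f (suc (suc n))          ≡⟨ cong (_* f (suc (suc n))) (∏-shift n f) ⟩
    f 1 * ∏ n (f ∘ suc) * f (suc (suc n))  ≡⟨ ℤ.*-assoc (f 1) _ _ ⟩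
    f 1 * ∏ (suc n) (f ∘ suc)              ∎

  ∏-reverse : ∀ n (f : ℕ → ℤ) → ∏ n f ≡ ∏ n (λ k → f (suc n ∸ k))
  ∏-reverse zero    f = refl
  ∏-reverse (suc n) f = begin
    ∏ (suc n) f                            ≡⟨ ∏-shift n f ⟩
    f 1 * ∏ n (f ∘ suc)                    ≡⟨ cong (f 1 *_) (∏-reverse n (f ∘ suc)) ⟩
    f 1 * ∏ n (λ k → f (suc (suc n ∸ k)))  ≡⟨ ℤ.*-comm (f 1) _ ⟩
    ∏ n (λ k → f (suc (suc n ∸ k))) * f 1  ≡⟨ cong₂ _*_ (∏-cong n λ _ k≤n → cong f (sym
                                                (ℕ.+-∸-assoc 1 (ℕ.m≤n⇒m≤1+n k≤n))))
                                                (cong f (sym (ℕ.m+n∸n≡m 1 n))) ⟩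
    ∏ (suc n) (λ k → f (suc (suc n) ∸ k))  ∎

  ∏-update : ∀ n {f g : ℕ → ℤ} {b} → 1 ≤ b → b ≤ n → f b ≡ 1ℤ →
             (∀ {k} → 1 ≤ k → k ≤ n → k ≢ b → g k ≡ f k) → ∏ n g ≡ ∏ n f * g b
  ∏-update zero (s≤s _) ()
  ∏-update (suc n) {f} {g} {b} 1≤b b≤n fb≡1 g≗f with ℕ.m≤n⇒m<n∨m≡n b≤n
  ... | inj₂ refl = begin
    ∏ n g * g (suc n)              ≡⟨ cong (_* g (suc n)) (∏-cong n λ 1≤k k≤n →
                                        g≗f 1≤k (ℕ.m≤n⇒m≤1+n k≤n) (ℕ.<⇒≢ (s≤s k≤n))) ⟩
    ∏ n f * g (suc n)              ≡⟨ cong (_* g (suc n)) (ℤ.*-identityʳ (∏ n f)) ⟨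
    ∏ n f * 1ℤ * g (suc n)         ≡⟨ cong (λ x → ∏ n f * x * g (suc n)) fb≡1 ⟨
    ∏ n f * f (suc n) * g (suc n)  ∎
  ... | inj₁ (s≤s b≤n′) = begin
    ∏ n g * g (suc n)              ≡⟨ cong₂ _*_
                                        (∏-update n 1≤b b≤n′ fb≡1 λ 1≤k k≤n → g≗f 1≤k (ℕ.m≤n⇒m≤1+n k≤n))
                                        (g≗f (s≤s z≤n) ℕ.≤-refl (ℕ.<⇒≢ (s≤s b≤n′) ∘ sym)) ⟩
    ∏ n f * g b * f (suc n)        ≡⟨ xy∙z≈xz∙y (∏ n f) (g b) (f (suc n)) ⟩
    ∏ n f * f (suc n) * g b        ∎

  ∏-+≡! : ∀ n → ∏ n (λ k → + k) ≡ + (n !)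
  ∏-+≡! zero    = refl
  ∏-+≡! (suc n) = begin
    ∏ n (λ k → + k) * + suc n  ≡⟨ cong (_* + suc n) (∏-+≡! n) ⟩
    + (n !) * + suc n          ≡⟨ ℤ.*-comm (+ (n !)) (+ suc n) ⟩
    + suc n * + (n !)          ≡⟨ ℤ.pos-* (suc n) (n !) ⟨
    + (suc n !)                ∎

  ∏-falling≡! : ∀ n → ∏ n (λ k → + (suc n ∸ k)) ≡ + (n !)
  ∏-falling≡! n = trans (sym (∏-reverse n (λ k → + k))) (∏-+≡! n)

  ∏-rising : ∀ a b → ∏ b (λ i → + (a ℕ.+ i)) * + (a !) ≡ + ((a ℕ.+ b) !)
  ∏-rising a zero    = trans (ℤ.*-identityˡ _) (cong (λ c → + (c !)) (sym (ℕ.+-identityʳ a)))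
  ∏-rising a (suc b) rewrite ℕ.+-suc a b = begin
    rising * + suc (a ℕ.+ b) * + (a !)    ≡⟨ xy∙z≈y∙xz rising (+ suc (a ℕ.+ b)) (+ (a !)) ⟩
    + suc (a ℕ.+ b) * (rising * + (a !))  ≡⟨ cong (+ suc (a ℕ.+ b) *_) (∏-rising a b) ⟩
    + suc (a ℕ.+ b) * + ((a ℕ.+ b) !)     ≡⟨ ℤ.pos-* (suc (a ℕ.+ b)) ((a ℕ.+ b) !) ⟨
    + (suc (a ℕ.+ b) !)                   ∎
    where
    rising = ∏ b (λ i → + (a ℕ.+ i))

  pos-∸ : ∀ {m n} → n ≤ m → + (m ∸ n) ≡ + m - + n
  pos-∸ {m} {n} n≤m = trans (sym (ℤ.⊖-≥ n≤m)) (sym (ℤ.m-n≡m⊖n m n))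

  pos-+-* : ∀ a b c d e → a ℕ.+ b ℕ.* c ≡ d ℕ.* e → + a + + b * + c ≡ + d * + e
  pos-+-* a b c d e eq = begin
    + a + + b * + c    ≡⟨ cong (_+_ (+ a)) (ℤ.pos-* b c) ⟨
    + a + + (b ℕ.* c)  ≡⟨ ℤ.pos-+ a (b ℕ.* c) ⟨
    + (a ℕ.+ b ℕ.* c)  ≡⟨ cong +_ eq ⟩
    + (d ℕ.* e)        ≡⟨ ℤ.pos-* d e ⟩
    + d * + e          ∎

  [a+b]-a≡b : ∀ a b → a + b - a ≡ b
  [a+b]-a≡b = solve-∀

  ∏-difference-of-squares : ∀ k →
    + suc k * ∏ k (λ i → + suc k * + suc k - + i * + i) ≡ + ((suc k ℕ.+ k) !)
  ∏-difference-of-squares k = begin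
    + j * ∏ k (λ i → + j * + j - + i * + i)    ≡⟨ cong (+ j *_) (∏-cong k factorise) ⟩
    + j * ∏ k (λ i → + (j ∸ i) * + (j ℕ.+ i))  ≡⟨ cong (+ j *_) (∏-distrib-* k _ _) ⟩
    + j * (∏ k (λ i → + (j ∸ i)) * rising)     ≡⟨ cong (λ x → + j * (x * rising)) (∏-falling≡! k) ⟩
    + j * (+ (k !) * rising)                   ≡⟨ ℤ.*-assoc (+ j) (+ (k !)) rising ⟨
    + j * + (k !) * rising                     ≡⟨ cong (_* rising) (ℤ.pos-* j (k !)) ⟨
    + (j !) * rising                           ≡⟨ ℤ.*-comm (+ (j !)) rising ⟩
    rising * + (j !)                           ≡⟨ ∏-rising j k ⟩
    + ((j ℕ.+ k) !)                            ∎
    where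
    j = suc k
    rising = ∏ k (λ i → + (j ℕ.+ i))
    squares : ∀ a b → a * a - b * b ≡ (a - b) * (a + b)
    squares = solve-∀
    factorise : ∀ {i} → 1 ≤ i → i ≤ k → + j * + j - + i * + i ≡ + (j ∸ i) * + (j ℕ.+ i)
    factorise {i} _ i≤k = trans (squares (+ j) (+ i))
      (cong₂ _*_ (sym (pos-∸ (ℕ.m≤n⇒m≤1+n i≤k))) (sym (ℤ.pos-+ j i)))

  oddFactorial : ℕ → ℤ
  oddFactorial j = + ((j ℕ.+ (j ∸ 1)) !)

  pairProd-*-! : ∀ m → pairProd m * + (m !) ≡ ∏ m oddFactorial
  pairProd-*-! m = begin
    pairProd m * + (m !)                                        ≡⟨ cong (pairProd m *_) (∏-+≡! m) ⟨
    pairProd m * ∏ m (λ k → + k)                                ≡⟨ ∏-distrib-* m _ (λ k → + k) ⟨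
    ∏ m (λ j → ∏ (j ∸ 1) (λ i → + j * + j - + i * + i) * + j)  ≡⟨ ∏-cong m row ⟩
    ∏ m oddFactorial                                            ∎
    where
    row : ∀ {j} → 1 ≤ j → j ≤ m → ∏ (j ∸ 1) (λ i → + j * + j - + i * + i) * + j ≡ oddFactorial j
    row {suc k} _ _ = trans (ℤ.*-comm _ (+ suc k)) (∏-difference-of-squares k)

-1^[n+n]≡1 : ∀ n → -1ℤ ^ (n ℕ.+ n) ≡ 1ℤ
-1^[n+n]≡1 zero    = refl
-1^[n+n]≡1 (suc n) rewrite ℕ.+-suc n n | -1^[n+n]≡1 n = refl

n+n≢1+m+m : ∀ n m → n ℕ.+ n ≢ suc (m ℕ.+ m)
n+n≢1+m+m n m eq = ℕ.even≢odd n m (trans (cong (n ℕ.+_) (ℕ.+-identityʳ n))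
  (trans eq (cong (λ x → suc (m ℕ.+ x)) (sym (ℕ.+-identityʳ m)))))

module Congruence (n : ℕ) where

  -- A record rather than a synonym for divisibility, so that a and b can be inferred from a ≈ b.
  infix 4 _≈_
  record _≈_ (a b : ℤ) : Set where
    constructor congruent
    field
      divides-difference : + n Signed.∣ a - b

  private
    subst-∣ : ∀ {a b} → a ≡ b → + n Signed.∣ a → + n Signed.∣ b
    subst-∣ = subst (+ n Signed.∣_)

  ≈-reflexive : ∀ {a b} → a ≡ b → a ≈ b
  ≈-reflexive {a} refl = congruent (divides 0ℤ (ℤ.+-inverseʳ a))

  ≈-refl : ∀ {a} → a ≈ a
  ≈-refl = ≈-reflexive refl

  ≈-sym : ∀ {a b} → a ≈ b → b ≈ a
  ≈-sym {a} {b} (congruent n∣a-b) = congruent (subst-∣ (negate a b) (∣m⇒∣-m n∣a-b))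
    where
    negate : ∀ a b → - (a - b) ≡ b - a
    negate = solve-∀

  ≈-trans : ∀ {a b c} → a ≈ b → b ≈ c → a ≈ c
  ≈-trans {a} {b} {c} (congruent n∣a-b) (congruent n∣b-c) =
    congruent (subst-∣ (telescope a b c) (∣m∣n⇒∣m+n n∣a-b n∣b-c))
    where
    telescope : ∀ a b c → (a - b) + (b - c) ≡ a - c
    telescope = solve-∀

  ≈-setoid : Setoid 0ℓ 0ℓ
  ≈-setoid = record
    { Carrier       = ℤ
    ; _≈_           = _≈_
    ; isEquivalence = record { refl = ≈-refl ; sym = ≈-sym ; trans = ≈-trans }
    }

  module ≈-Reasoning = SetoidReasoning ≈-setoid

  +-cong : ∀ {a b c d} → a ≈ b → c ≈ d → a + c ≈ b + d
  +-cong {a} {b} {c} {d} (congruent n∣a-b) (congruent n∣c-d) =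
    congruent (subst-∣ (regroup a b c d) (∣m∣n⇒∣m+n n∣a-b n∣c-d))
    where
    regroup : ∀ a b c d → (a - b) + (c - d) ≡ (a + c) - (b + d)
    regroup = solve-∀

  *-cong : ∀ {a b c d} → a ≈ b → c ≈ d → a * c ≈ b * d
  *-cong {a} {b} {c} {d} (congruent n∣a-b) (congruent n∣c-d) =
    congruent (subst-∣ (regroup a b c d) (∣m∣n⇒∣m+n (∣m⇒∣m*n c n∣a-b) (∣n⇒∣m*n b n∣c-d)))
    where
    regroup : ∀ a b c d → (a - b) * c + b * (c - d) ≡ a * c - b * d
    regroup = solve-∀

  neg-cong : ∀ {a b} → a ≈ b → - a ≈ - b
  neg-cong {a} {b} (congruent n∣a-b) = congruent (subst-∣ (negate a b) (∣m⇒∣-m n∣a-b))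
    where
    negate : ∀ a b → - (a - b) ≡ - a - - b
    negate = solve-∀

  ∏-cong≈ : ∀ m {f g : ℕ → ℤ} → (∀ {k} → 1 ≤ k → k ≤ m → f k ≈ g k) → ∏ m f ≈ ∏ m g
  ∏-cong≈ zero    f≈g = ≈-refl
  ∏-cong≈ (suc m) f≈g =
    *-cong (∏-cong≈ m λ 1≤k k≤m → f≈g 1≤k (ℕ.m≤n⇒m≤1+n k≤m)) (f≈g (s≤s z≤n) ℕ.≤-refl)

  ≈0⇒∣ : ∀ {a} → a ≈ 0ℤ → + n Signed.∣ a
  ≈0⇒∣ {a} (congruent n∣a-0) = subst-∣ (ℤ.+-identityʳ a) n∣a-0

  ∣⇒≈0 : ∀ {a} → + n Signed.∣ a → a ≈ 0ℤ
  ∣⇒≈0 {a} n∣a = congruent (subst-∣ (sym (ℤ.+-identityʳ a)) n∣a)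

  -≈0⇒≈ : ∀ {a b} → a - b ≈ 0ℤ → a ≈ b
  -≈0⇒≈ = congruent ∘ ≈0⇒∣

  ≈⇒-≈0 : ∀ {a b} → a ≈ b → a - b ≈ 0ℤ
  ≈⇒-≈0 (congruent n∣a-b) = ∣⇒≈0 n∣a-b

  +≡n⇒≈-neg : ∀ {a b} → a + b ≡ + n → a ≈ - b
  +≡n⇒≈-neg {a} {b} a+b≡n = congruent (divides 1ℤ (begin
    a - - b    ≡⟨ cong (_+_ a) (ℤ.neg-involutive b) ⟩
    a + b      ≡⟨ a+b≡n ⟩
    + n        ≡⟨ ℤ.*-identityˡ (+ n) ⟨
    1ℤ * + n   ∎))
    where open ≡-Reasoning

  private
    ∣∧<⇒≡0 : ∀ {d} → n ℕ.∣ d → d < n → d ≡ 0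
    ∣∧<⇒≡0 {zero}  _   _   = refl
    ∣∧<⇒≡0 {suc d} n∣d d<n = contradiction (ℕ.∣⇒≤ n∣d) (ℕ.<⇒≱ d<n)

    ≈⇒≡-≥ : ∀ {x y} → y ≤ x → x < n → + x ≈ + y → x ≡ y
    ≈⇒≡-≥ {x} {y} y≤x x<n (congruent n∣x-y) = ℕ.≤-antisym (ℕ.m∸n≡0⇒m≤n x∸y≡0) y≤x
      where
      x∸y≡0 : x ∸ y ≡ 0
      x∸y≡0 = ∣∧<⇒≡0 (∣⇒∣ᵤ (subst-∣ (sym (pos-∸ y≤x)) n∣x-y))
                     (ℕ.≤-<-trans (ℕ.m∸n≤m x y) x<n)

  ≈⇒≡ : ∀ {x y} → x < n → y < n → + x ≈ + y → x ≡ y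
  ≈⇒≡ {x} {y} x<n y<n x≈y with ℕ.≤-total y x
  ... | inj₁ y≤x = ≈⇒≡-≥ y≤x x<n x≈y
  ... | inj₂ x≤y = sym (≈⇒≡-≥ x≤y y<n (≈-sym x≈y))

  ≈-1⇒suc≡ : ∀ {a} → a < n → + a ≈ -1ℤ → suc a ≡ n
  ≈-1⇒suc≡ {a} a<n (congruent n∣a+1) = ℕ.≤-antisym a<n (ℕ.∣⇒≤ (∣⇒∣ᵤ n∣suc-a))
    where
    n∣suc-a : + n Signed.∣ + suc a
    n∣suc-a = subst-∣ (trans (sym (ℤ.pos-+ a 1)) (cong +_ (ℕ.+-comm a 1))) n∣a+1

  inverse-unique : ∀ {a b c} → a * b ≈ 1ℤ → a * c ≈ 1ℤ → b ≈ c
  inverse-unique {a} {b} {c} ab≈1 ac≈1 = begin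
    b            ≡⟨ ℤ.*-identityʳ b ⟨
    b * 1ℤ       ≈⟨ *-cong (≈-refl {b}) ac≈1 ⟨
    b * (a * c)  ≡⟨ ℤ.*-assoc b a c ⟨
    b * a * c    ≡⟨ cong (_* c) (ℤ.*-comm b a) ⟩
    a * b * c    ≈⟨ *-cong ab≈1 (≈-refl {c}) ⟩
    1ℤ * c       ≡⟨ ℤ.*-identityˡ c ⟩
    c            ∎
    where open ≈-Reasoning

  unit-cancel : ∀ {a u v} → u * v ≈ 1ℤ → a * u ≈ 0ℤ → a ≈ 0ℤ
  unit-cancel {a} {u} {v} uv≈1 au≈0 = begin
    a            ≡⟨ ℤ.*-identityʳ a ⟨
    a * 1ℤ       ≈⟨ *-cong (≈-refl {a}) uv≈1 ⟨
    a * (u * v)  ≡⟨ ℤ.*-assoc a u v ⟨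
    a * u * v    ≈⟨ *-cong au≈0 (≈-refl {v}) ⟩
    0ℤ * v       ≡⟨ ℤ.*-zeroˡ v ⟩
    0ℤ           ∎
    where open ≈-Reasoning

  ≈-residue : .{{_ : NonZero n}} → ∀ a → a ≈ + (a %ℕ n)
  ≈-residue a = congruent (divides (a /ℕ n) (begin
    a - + r              ≡⟨ cong (_- + r) (a≡a%ℕn+[a/ℕn]*n a n) ⟩
    + r + q * + n - + r  ≡⟨ [a+b]-a≡b (+ r) (q * + n) ⟩
    q * + n              ∎))
    where
    open ≡-Reasoning
    r = a %ℕ n
    q = a /ℕ n

  bézout-≈ : ∀ {d m} → Bézout.Identity d m n → Σ[ c ∈ ℤ ] + m * c ≈ + d
  bézout-≈ {d} {m} (Bézout.+- x y eq) = + x , congruent (divides (+ y) (begin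
    + m * + x - + d            ≡⟨ cong (_- + d) (ℤ.*-comm (+ m) (+ x)) ⟩
    + x * + m - + d            ≡⟨ cong (_- + d) (pos-+-* d y n x m eq) ⟨
    + d + + y * + n - + d      ≡⟨ [a+b]-a≡b (+ d) (+ y * + n) ⟩
    + y * + n                  ∎))
    where open ≡-Reasoning
  bézout-≈ {d} {m} (Bézout.-+ x y eq) = - + x , congruent (divides (- + y) (begin
    + m * - + x - + d          ≡⟨ negate (+ m) (+ x) (+ d) ⟩
    - (+ d + + x * + m)        ≡⟨ cong -_ (pos-+-* d x m y n eq) ⟩
    - (+ y * + n)              ≡⟨ ℤ.neg-distribˡ-* (+ y) (+ n) ⟩
    - + y * + n                ∎))
    where
    open ≡-Reasoning
    negate : ∀ a b c → a * - b - c ≡ - (c + b * a)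
    negate = solve-∀

  module _ (N : ℕ) (ι : ℕ → ℕ) (f : ℕ → ℤ)
           (ι-range : ∀ {k} → 1 ≤ k → k ≤ N → 1 ≤ ι k × ι k ≤ N)
           (ι-involutive : ∀ {k} → 1 ≤ k → k ≤ N → ι (ι k) ≡ k)
           (fixed≈1 : ∀ {k} → 1 ≤ k → k ≤ N → ι k ≡ k → f k ≈ 1ℤ)
           (pair≈1 : ∀ {k} → 1 ≤ k → k ≤ N → f k * f (ι k) ≈ 1ℤ)
           where

    -- restricted m keeps f k exactly when the partner ι k is also at most m, so over 1..m it
    -- consists of whole pairs and fixed points; raising m by one adds at most one pair.
    private
      restricted : ℕ → ℕ → ℤ
      restricted m k = if does (ι k ≤? m) then f k else 1ℤ

      restricted-≤ : ∀ {m k} → ι k ≤ m → restricted m k ≡ f k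
      restricted-≤ {m} {k} ιk≤m = cong (λ b → if b then f k else 1ℤ) (dec-true (ι k ≤? m) ιk≤m)

      restricted-> : ∀ {m k} → m < ι k → restricted m k ≡ 1ℤ
      restricted-> {m} {k} m<ιk =
        cong (λ b → if b then f k else 1ℤ) (dec-false (ι k ≤? m) (ℕ.<⇒≱ m<ιk))

      restricted-suc : ∀ {m k} → suc m ≤ N → 1 ≤ k → k ≤ m → k ≢ ι (suc m) →
                       restricted (suc m) k ≡ restricted m k
      restricted-suc {m} {k} m<N 1≤k k≤m k≢ιj with ι k ≤? m
      ... | yes ιk≤m = trans (restricted-≤ (ℕ.m≤n⇒m≤1+n ιk≤m)) (sym (restricted-≤ ιk≤m))
      ... | no  ιk≰m = trans (restricted-> j<ιk) (sym (restricted-> (ℕ.≰⇒> ιk≰m)))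
        where
        j<ιk : suc m < ι k
        j<ιk = ℕ.≤∧≢⇒< (ℕ.≰⇒> ιk≰m) λ j≡ιk →
          k≢ιj (trans (sym (ι-involutive 1≤k (ℕ.≤-trans k≤m (ℕ.<⇒≤ m<N)))) (cong ι (sym j≡ιk)))

      restricted-self≈1 : ∀ {j} → 1 ≤ j → j ≤ N → j ≤ ι j → restricted j j ≈ 1ℤ
      restricted-self≈1 {j} 1≤j j≤N j≤ιj with ι j ≤? j
      ... | yes ιj≤j = ≈-trans (≈-reflexive (restricted-≤ ιj≤j))
                               (fixed≈1 1≤j j≤N (ℕ.≤-antisym ιj≤j j≤ιj))
      ... | no  ιj≰j = ≈-reflexive (restricted-> (ℕ.≰⇒> ιj≰j))

      ∏-restricted-step≤ : ∀ {m} → suc m ≤ N → suc m ≤ ι (suc m) →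
                           ∏ (suc m) (restricted (suc m)) ≈ ∏ m (restricted m)
      ∏-restricted-step≤ {m} j≤N j≤ιj = begin
        ∏ m (restricted j) * restricted j j  ≡⟨ cong (_* restricted j j) (∏-cong m λ 1≤k k≤m →
                                                  restricted-suc j≤N 1≤k k≤m (k≢ιj k≤m)) ⟩
        ∏ m (restricted m) * restricted j j  ≈⟨ *-cong (≈-refl {∏ m (restricted m)})
                                                  (restricted-self≈1 (s≤s z≤n) j≤N j≤ιj) ⟩
        ∏ m (restricted m) * 1ℤ              ≡⟨ ℤ.*-identityʳ (∏ m (restricted m)) ⟩
        ∏ m (restricted m)                   ∎
        where
        open ≈-Reasoning
        j = suc m
        k≢ιj : ∀ {k} → k ≤ m → k ≢ ι j
        k≢ιj k≤m refl = ℕ.<⇒≱ (s≤s k≤m) j≤ιj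

      ∏-restricted-step> : ∀ {m} → suc m ≤ N → ι (suc m) < suc m →
                           ∏ (suc m) (restricted (suc m)) ≈ ∏ m (restricted m)
      ∏-restricted-step> {m} j≤N b<j = begin
        ∏ m (restricted j) * restricted j j
          ≡⟨ cong (_* restricted j j) (∏-update m 1≤b (ℕ.≤-pred b<j) partner-absent λ 1≤k k≤m →
               restricted-suc j≤N 1≤k k≤m) ⟩
        ∏ m (restricted m) * restricted j b * restricted j j
          ≡⟨ cong₂ (λ x y → ∏ m (restricted m) * x * y)
               (restricted-≤ (ℕ.≤-reflexive ιb≡j)) (restricted-≤ (ℕ.<⇒≤ b<j)) ⟩
        ∏ m (restricted m) * f b * f j
          ≡⟨ xy∙z≈x∙zy (∏ m (restricted m)) (f b) (f j) ⟩
        ∏ m (restricted m) * (f j * f b)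
          ≈⟨ *-cong (≈-refl {∏ m (restricted m)}) (pair≈1 (s≤s z≤n) j≤N) ⟩
        ∏ m (restricted m) * 1ℤ
          ≡⟨ ℤ.*-identityʳ (∏ m (restricted m)) ⟩
        ∏ m (restricted m)
          ∎
        where
        open ≈-Reasoning
        j = suc m
        b = ι j
        1≤b : 1 ≤ b
        1≤b = proj₁ (ι-range (s≤s z≤n) j≤N)
        ιb≡j : ι b ≡ j
        ιb≡j = ι-involutive (s≤s z≤n) j≤N
        partner-absent : restricted m b ≡ 1ℤ
        partner-absent = restricted-> (subst (m <_) (sym ιb≡j) (ℕ.n<1+n m))

      ∏-restricted-step : ∀ m → suc m ≤ N → ∏ (suc m) (restricted (suc m)) ≈ ∏ m (restricted m)
      ∏-restricted-step m j≤N with suc m ≤? ι (suc m)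
      ... | yes j≤ιj = ∏-restricted-step≤ j≤N j≤ιj
      ... | no  j≰ιj = ∏-restricted-step> j≤N (ℕ.≰⇒> j≰ιj)

      ∏-restricted≈1 : ∀ m → m ≤ N → ∏ m (restricted m) ≈ 1ℤ
      ∏-restricted≈1 zero    _   = ≈-refl
      ∏-restricted≈1 (suc m) m<N =
        ≈-trans (∏-restricted-step m m<N) (∏-restricted≈1 m (ℕ.<⇒≤ m<N))

    ∏-pairs≈1 : ∏ N f ≈ 1ℤ
    ∏-pairs≈1 = ≈-trans
      (≈-reflexive (∏-cong N λ 1≤k k≤N → sym (restricted-≤ (proj₂ (ι-range 1≤k k≤N)))))
      (∏-restricted≈1 N ℕ.≤-refl)

module _ {p : ℕ} (p-prime : Prime p) where
  open Congruence p
  open ≈-Reasoning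

  private
    instance
      p≢0 : NonZero p
      p≢0 = prime⇒nonZero p-prime

  1<p : 1 < p
  1<p = ℕ.nonTrivial⇒n>1 p {{prime⇒nonTrivial p-prime}}

  0≉1 : ¬ (0ℤ ≈ 1ℤ)
  0≉1 0≈1 = contradiction (≈⇒≡ (ℕ.<-trans (s≤s z≤n) 1<p) 1<p 0≈1) λ ()

  ≈0-euclid : ∀ a b → a * b ≈ 0ℤ → a ≈ 0ℤ ⊎ b ≈ 0ℤ
  ≈0-euclid a b ab≈0 = Sum.map (∣⇒≈0 ∘ ∣ᵤ⇒∣) (∣⇒≈0 ∘ ∣ᵤ⇒∣)
    (euclidsLemma ∣ a ∣ ∣ b ∣ p-prime (subst (p ℕ.∣_) (ℤ.abs-* a b) (∣⇒∣ᵤ (≈0⇒∣ ab≈0))))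

  square≈1 : ∀ a → a * a ≈ 1ℤ → a ≈ 1ℤ ⊎ a ≈ -1ℤ
  square≈1 a a²≈1 = Sum.map -≈0⇒≈ -≈0⇒≈ (≈0-euclid (a - 1ℤ) (a - -1ℤ) (begin
    (a - 1ℤ) * (a - -1ℤ)  ≡⟨ factorise a ⟩
    a * a - 1ℤ            ≈⟨ ≈⇒-≈0 a²≈1 ⟩
    0ℤ                    ∎))
    where
    factorise : ∀ a → (a - + 1) * (a - - + 1) ≡ a * a - + 1
    factorise = solve-∀

  pred-≈-1 : ∀ {a} → suc a ≡ p → + a ≈ -1ℤ
  pred-≈-1 {a} refl = +≡n⇒≈-neg (trans (sym (ℤ.pos-+ a 1)) (cong +_ (ℕ.+-comm a 1)))

  private
    coefficient : ℕ → ℤ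
    coefficient k = proj₁ (bézout-≈ (Bézout.identity (gcd-GCD k p)))

  inverse : ℕ → ℕ
  inverse k = coefficient k %ℕ p

  inverse<p : ∀ k → inverse k < p
  inverse<p k = n%ℕd<d (coefficient k) p

  inverse-* : ∀ {k} → 1 ≤ k → k < p → + k * + inverse k ≈ 1ℤ
  inverse-* {suc k} _ k<p = begin
    + suc k * + inverse (suc k)    ≈⟨ *-cong (≈-refl {+ suc k}) (≈-residue (coefficient (suc k))) ⟨
    + suc k * coefficient (suc k)  ≈⟨ proj₂ (bézout-≈ (Bézout.identity (gcd-GCD (suc k) p))) ⟩
    + gcd (suc k) p                ≡⟨ cong +_ (coprime⇒gcd≡1 (coprime-sym (prime⇒coprime p-prime k<p))) ⟩
    1ℤ                             ∎

  *≈1⇒positive : ∀ {a b} → + a * + b ≈ 1ℤ → 1 ≤ b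
  *≈1⇒positive {a} {zero}  a0≈1 =
    contradiction (≈-trans (≈-reflexive (sym (ℤ.*-zeroʳ (+ a)))) a0≈1) 0≉1
  *≈1⇒positive {b = suc _} _    = s≤s z≤n

  inverse-involutive : ∀ {k} → 1 ≤ k → k < p → inverse (inverse k) ≡ k
  inverse-involutive {k} 1≤k k<p = ≈⇒≡ (inverse<p (inverse k)) k<p
    (inverse-unique {+ inverse k} (inverse-* (*≈1⇒positive {k} kk⁻¹≈1) (inverse<p k))
                    (≈-trans (≈-reflexive (ℤ.*-comm (+ inverse k) (+ k))) kk⁻¹≈1))
    where
    kk⁻¹≈1 = inverse-* 1≤k k<p

  wilson : ∀ {w} → suc w ≡ p → + (w !) ≈ -1ℤ
  wilson {zero}  refl = contradiction 1<p (ℕ.<-irrefl refl)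
  wilson {suc q} refl = begin
    + (suc q !)        ≡⟨ ℤ.pos-* (suc q) (q !) ⟩
    + suc q * + (q !)  ≈⟨ *-cong (pred-≈-1 refl) q!≈1 ⟩
    -1ℤ * 1ℤ           ≡⟨⟩
    -1ℤ                ∎
    where
    k<p : ∀ {k} → k ≤ q → k < p
    k<p = s≤s ∘ ℕ.m≤n⇒m≤1+n
    ≉-1 : ∀ {k} → k ≤ q → ¬ (+ k ≈ -1ℤ)
    ≉-1 k≤q k≈-1 = ℕ.<-irrefl (ℕ.suc-injective (≈-1⇒suc≡ (k<p k≤q) k≈-1)) (s≤s k≤q)
    inverse-range : ∀ {k} → 1 ≤ k → k ≤ q → 1 ≤ inverse k × inverse k ≤ q
    inverse-range {k} 1≤k k≤q =
      *≈1⇒positive {k} kk⁻¹≈1 , ℕ.≤-pred (ℕ.≤∧≢⇒< (ℕ.≤-pred (inverse<p k)) k⁻¹≢p-1)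
      where
      kk⁻¹≈1 = inverse-* 1≤k (k<p k≤q)
      k⁻¹≢p-1 : inverse k ≢ suc q
      k⁻¹≢p-1 k⁻¹≡p-1 = ≉-1 k≤q (inverse-unique {+ suc q}
        (≈-trans (≈-reflexive (ℤ.*-comm (+ suc q) (+ k)))
                 (subst (λ b → + k * + b ≈ 1ℤ) k⁻¹≡p-1 kk⁻¹≈1))
        (*-cong (pred-≈-1 refl) (≈-refl { -1ℤ})))
    inverse-fixed : ∀ {k} → 1 ≤ k → k ≤ q → inverse k ≡ k → + k ≈ 1ℤ
    inverse-fixed {k} 1≤k k≤q k⁻¹≡k =
      Sum.[ id , (λ k≈-1 → contradiction k≈-1 (≉-1 k≤q)) ]
        (square≈1 (+ k) (subst (λ b → + k * + b ≈ 1ℤ) k⁻¹≡k (inverse-* 1≤k (k<p k≤q))))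
    q!≈1 : + (q !) ≈ 1ℤ
    q!≈1 = ≈-trans (≈-reflexive (sym (∏-+≡! q)))
      (∏-pairs≈1 q inverse (λ k → + k) inverse-range
                 (λ 1≤k k≤q → inverse-involutive 1≤k (k<p k≤q))
                 inverse-fixed
                 (λ 1≤k k≤q → inverse-* 1≤k (k<p k≤q)))

  reflection : ∀ {a b} → suc (a ℕ.+ b) ≡ p → -1ℤ ^ b * (+ (a !) * + (b !)) ≈ -1ℤ
  reflection {a} {b} a+b+1≡p = begin
    -1ℤ ^ b * (+ (a !) * + (b !))          ≡⟨ x∙yz≈y∙xz (-1ℤ ^ b) (+ (a !)) (+ (b !)) ⟩
    + (a !) * (-1ℤ ^ b * + (b !))          ≡⟨ cong (λ x → + (a !) * (-1ℤ ^ b * x)) (∏-falling≡! b) ⟨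
    + (a !) * (-1ℤ ^ b * ∏ b falling)      ≡⟨ cong (+ (a !) *_) (∏-neg b falling) ⟨
    + (a !) * ∏ b (λ i → - falling i)      ≈⟨ *-cong (≈-refl {+ (a !)}) (∏-cong≈ b λ _ i≤b →
                                                ≈-sym (+≡n⇒≈-neg (complement i≤b))) ⟩
    + (a !) * rising                       ≡⟨ ℤ.*-comm (+ (a !)) rising ⟩
    rising * + (a !)                       ≡⟨ ∏-rising a b ⟩
    + ((a ℕ.+ b) !)                        ≈⟨ wilson a+b+1≡p ⟩
    -1ℤ                                    ∎
    where
    falling : ℕ → ℤ
    falling i = + (suc b ∸ i)
    rising = ∏ b (λ i → + (a ℕ.+ i))
    complement : ∀ {i} → i ≤ b → + (a ℕ.+ i) + falling i ≡ + p
    complement {i} i≤b = trans (sym (ℤ.pos-+ (a ℕ.+ i) (suc b ∸ i))) (cong +_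
      (trans (ℕ.+-assoc a i (suc b ∸ i))
      (trans (cong (a ℕ.+_) (ℕ.m+[n∸m]≡n (ℕ.m≤n⇒m≤1+n i≤b)))
      (trans (ℕ.+-suc a b) a+b+1≡p))))

  reflection-odd : ∀ {a r} → suc (a ℕ.+ suc (r ℕ.+ r)) ≡ p → + (a !) * + (suc (r ℕ.+ r) !) ≈ 1ℤ
  reflection-odd {a} {r} eq = begin
    x                            ≡⟨ ℤ.neg-involutive x ⟨
    - - x                        ≡⟨ cong -_ (ℤ.-1*i≡-i x) ⟨
    - (-1ℤ * x)                  ≡⟨ cong (λ s → - (-1ℤ * s * x)) (-1^[n+n]≡1 r) ⟨
    - (-1ℤ ^ suc (r ℕ.+ r) * x)  ≈⟨ neg-cong (reflection {a} {suc (r ℕ.+ r)} eq) ⟩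
    - -1ℤ                        ≡⟨⟩
    1ℤ                           ∎
    where
    x = + (a !) * + (suc (r ℕ.+ r) !)

  reflection-even : ∀ {a r} → suc (a ℕ.+ (r ℕ.+ r)) ≡ p → + (a !) * + ((r ℕ.+ r) !) ≈ -1ℤ
  reflection-even {a} {r} eq = begin
    x                        ≡⟨ ℤ.*-identityˡ x ⟨
    1ℤ * x                   ≡⟨ cong (_* x) (-1^[n+n]≡1 r) ⟨
    -1ℤ ^ (r ℕ.+ r) * x      ≈⟨ reflection {a} {r ℕ.+ r} eq ⟩
    -1ℤ                      ∎
    where
    x = + (a !) * + ((r ℕ.+ r) !)

  module _ (t : ℕ) (4t+1≡p : suc ((t ℕ.+ t) ℕ.+ (t ℕ.+ t)) ≡ p) where

    private
      m : ℕ
      m = t ℕ.+ t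

    oddFactorial-pair : ∀ {i j} → 1 ≤ i → 1 ≤ j → i ℕ.+ j ≡ suc m →
                        oddFactorial i * oddFactorial j ≈ 1ℤ
    oddFactorial-pair {suc k} {suc r} _ _ i+j≡m+1 =
      reflection-odd {suc k ℕ.+ k} {r} (trans exponents 4t+1≡p)
      where
      identity : ∀ k r →
        suc ((suc k ℕ.+ k) ℕ.+ suc (r ℕ.+ r)) ≡ suc ((k ℕ.+ suc r) ℕ.+ (k ℕ.+ suc r))
      identity = ℕ-Solver.solve-∀
      exponents : suc ((suc k ℕ.+ k) ℕ.+ suc (r ℕ.+ r)) ≡ suc (m ℕ.+ m)
      exponents = trans (identity k r) (cong (λ x → suc (x ℕ.+ x)) (ℕ.suc-injective i+j≡m+1))

    ∏-oddFactorial≈1 : ∏ m oddFactorial ≈ 1ℤ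
    ∏-oddFactorial≈1 = ∏-pairs≈1 m (λ j → suc m ∸ j) oddFactorial mirror-range mirror-involutive
      (λ {j} _ j≤m j′≡j → contradiction (mirror-fixed j≤m j′≡j) (n+n≢1+m+m j t))
      (λ {j} 1≤j j≤m → oddFactorial-pair 1≤j (proj₁ (mirror-range 1≤j j≤m))
                         (ℕ.m+[n∸m]≡n (ℕ.m≤n⇒m≤1+n j≤m)))
      where
      mirror-range : ∀ {j} → 1 ≤ j → j ≤ m → 1 ≤ suc m ∸ j × suc m ∸ j ≤ m
      mirror-range {suc k} _ j≤m = ℕ.m<n⇒0<n∸m j≤m , ℕ.m∸n≤m m k
      mirror-involutive : ∀ {j} → 1 ≤ j → j ≤ m → suc m ∸ (suc m ∸ j) ≡ j
      mirror-involutive _ j≤m = ℕ.m∸[m∸n]≡n (ℕ.m≤n⇒m≤1+n j≤m)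
      mirror-fixed : ∀ {j} → j ≤ m → suc m ∸ j ≡ j → j ℕ.+ j ≡ suc m
      mirror-fixed {j} j≤m j′≡j =
        trans (cong (ℕ._+ j) (sym j′≡j)) (ℕ.m∸n+n≡m (ℕ.m≤n⇒m≤1+n j≤m))

    pairProd+!≈0 : pairProd m + + (m !) ≈ 0ℤ
    pairProd+!≈0 = unit-cancel m!-unit (begin
      (pairProd m + + (m !)) * + (m !)          ≡⟨ ℤ.*-distribʳ-+ (+ (m !)) (pairProd m) (+ (m !)) ⟩
      pairProd m * + (m !) + + (m !) * + (m !)  ≡⟨ cong (_+ + (m !) * + (m !)) (pairProd-*-! m) ⟩
      ∏ m oddFactorial + + (m !) * + (m !)      ≈⟨ +-cong ∏-oddFactorial≈1 m!²≈-1 ⟩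
      1ℤ + -1ℤ                                  ≡⟨⟩
      0ℤ                                        ∎)
      where
      m!²≈-1 : + (m !) * + (m !) ≈ -1ℤ
      m!²≈-1 = reflection-even {m} {t} 4t+1≡p
      m!-unit : + (m !) * - + (m !) ≈ 1ℤ
      m!-unit = begin
        + (m !) * - + (m !)    ≡⟨ ℤ.neg-distribʳ-* (+ (m !)) (+ (m !)) ⟨
        - (+ (m !) * + (m !))  ≈⟨ neg-cong m!²≈-1 ⟩
        - -1ℤ                  ≡⟨⟩
        1ℤ                     ∎

    p∣pairProd+! : + p ∣ pairProd m + + (m !)
    p∣pairProd+! = ∣⇒∣ᵤ (≈0⇒∣ pairProd+!≈0)

1-mod-4-decomposition : ∀ p → p % 4 ≡ 1 →
  Σ[ t ∈ ℕ ] (p ∸ 1) / 2 ≡ t ℕ.+ t × suc ((t ℕ.+ t) ℕ.+ (t ℕ.+ t)) ≡ p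
1-mod-4-decomposition p p%4≡1 = t , half≡t+t , sym p≡4t+1
  where
  t = p / 4
  quadruple : ∀ t → 1 ℕ.+ t ℕ.* 4 ≡ suc ((t ℕ.+ t) ℕ.+ (t ℕ.+ t))
  quadruple = ℕ-Solver.solve-∀
  double : ∀ t → (t ℕ.+ t) ℕ.+ (t ℕ.+ t) ≡ (t ℕ.+ t) ℕ.* 2
  double = ℕ-Solver.solve-∀
  p≡4t+1 : p ≡ suc ((t ℕ.+ t) ℕ.+ (t ℕ.+ t))
  p≡4t+1 = trans (m≡m%n+[m/n]*n p 4) (trans (cong (ℕ._+ t ℕ.* 4) p%4≡1) (quadruple t))
  half≡t+t : (p ∸ 1) / 2 ≡ t ℕ.+ t
  half≡t+t = trans (cong (λ x → (x ∸ 1) / 2) p≡4t+1)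
                   (trans (cong (_/ 2) (double t)) (m*n/n≡m (t ℕ.+ t) 2))

lemma2p1 : (p : ℕ) → Prime p → p % 4 ≡ 1 →
    (+ p) ∣ (pairProd ((p Data.Nat.∸ 1) / 2) + + (((p Data.Nat.∸ 1) / 2) !))
lemma2p1 p p-prime p%4≡1 with 1-mod-4-decomposition p p%4≡1
... | t , half≡t+t , 4t+1≡p rewrite half≡t+t = p∣pairProd+! p-prime t 4t+1≡p
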